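{- Let $r=s^{2}$ with $s\ge 2$ an integer, $a(n)=\lfloor n/\sqrt{r}+\sqrt{r}/2\rfloor$ for $n\in\mathbb{Z}$, and $S(n)=\sum_{j=0}^{r-1}a(n-j)$. If $s$ is odd ($s=3,5,7,\dots$), then $a(S(n))=n$ for all $n\ge r$. If $s$ is even, then $a(S(n))\ne n$ for every $n\ge r$ (indeed $a(S(n))=n+1$). -}

module Defs where

open import Data.Nat using (ℕ; _+_; _*_; _∸_; NonZero)
open import Data.Nat.Properties using (m*n≢0)
open import Data.Nat.ListAction using (sum)
open import Data.Nat.DivMod using (_/_)
open import Data.List using (map; upTo)

-- a(n) = ⌊ n/√r + √r/2 ⌋ with r = s², so √r = s (s ≥ 2).
-- n/s + s/2 = (2n + s²)/(2s); the floor of a nonnegative rational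
-- p/q is the natural-number quotient p / q.
-- Only evaluated at naturals: all arguments n - j (n ≥ r, 0 ≤ j ≤ r-1) are ≥ 1.
a : (s : ℕ) → .{{NonZero s}} → ℕ → ℕ
a s n = (2 * n + s * s) / (2 * s)
  where instance _ = m*n≢0 2 s

-- S(n) = Σ_{j=0}^{r-1} a(n - j), r = s².  (Truncated subtraction is exact
-- here since the theorem only uses n ≥ r > j.)
S : (s : ℕ) → .{{NonZero s}} → ℕ → ℕ
S s n = sum (map (λ j → a s (n ∸ j)) (upTo (s * s)))

-- Since (2n + s²)/(2s) grows by exactly 1 when n grows by s, the sum of
-- s consecutive values a(c), …, a(c+s-1) equals a(0) + … + a(s-1) + c.
-- The s² summands of S(n) therefore split into s blocks of length s whose
-- sums form an arithmetic progression, and a direct count of a(0), …, a(s-1)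
-- gives 2·S(n) + s² + s·(s mod 2) = 2s(n+1).  Thus 2·S(n) + s² leaves
-- remainder s modulo 2s with quotient n when s is odd, and equals 2s(n+1)
-- when s is even.

module Submission where

open import Defs
open import Data.Nat using (ℕ; zero; suc; _+_; _*_; _∸_; _%_; _/_; _≤_; _<_; s≤s; z≤n; NonZero)
open import Data.Nat.Properties
open import Data.Nat.DivMod using (/-congˡ; +-distrib-/-∣ˡ; +-distrib-/-∣ʳ; m*n/n≡m; m<n⇒m/n≡0; n/n≡1; m%n<n; m≡m%n+[m/n]*n)
open import Data.Nat.Divisibility using (n∣m*n; ∣-refl)
open import Data.Nat.ListAction using (sum)
open import Data.Nat.Tactic.RingSolver using (solve-∀)
open import Data.List using (applyUpTo)
open import Data.List.Properties using (map-upTo)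
open import Data.Product using (_×_; _,_)
open import Relation.Binary.PropositionalEquality using (_≡_; _≢_; refl; sym; trans; subst; cong; cong₂; module ≡-Reasoning)

∑< : ℕ → (ℕ → ℕ) → ℕ
∑< k f = sum (applyUpTo f k)

syntax ∑< k (λ i → e) = ∑[ i < k ] e

∑-cong : ∀ {f g : ℕ → ℕ} k → (∀ i → f i ≡ g i) → ∑[ i < k ] f i ≡ ∑[ i < k ] g i
∑-cong zero    f≗g = refl
∑-cong (suc k) f≗g = cong₂ _+_ (f≗g 0) (∑-cong k (λ i → f≗g (suc i)))

∑-last : ∀ (f : ℕ → ℕ) k → ∑[ i < suc k ] f i ≡ ∑[ i < k ] f i + f k
∑-last f zero    = +-comm (f 0) 0
∑-last f (suc k) = trans (cong (f 0 +_) (∑-last (λ i → f (suc i)) k)) (sym (+-assoc (f 0) _ _))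

∑-split : ∀ (f : ℕ → ℕ) m n → ∑[ i < m + n ] f i ≡ ∑[ i < m ] f i + ∑[ i < n ] f (m + i)
∑-split f zero    n = refl
∑-split f (suc m) n = trans (cong (f 0 +_) (∑-split (λ i → f (suc i)) m n)) (sym (+-assoc (f 0) _ _))

∑-blocks : ∀ (f : ℕ → ℕ) k m → ∑[ i < k * m ] f i ≡ ∑[ q < k ] ∑[ i < m ] f (q * m + i)
∑-blocks f zero    m = refl
∑-blocks f (suc k) m = begin
  ∑[ i < m + k * m ] f i                                  ≡⟨ ∑-split f m (k * m) ⟩
  ∑[ i < m ] f i + ∑[ i < k * m ] f (m + i)               ≡⟨ cong (∑[ i < m ] f i +_) (∑-blocks (λ i → f (m + i)) k m) ⟩
  ∑[ i < m ] f i + ∑[ q < k ] ∑[ i < m ] f (m + (q * m + i))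
    ≡⟨ cong (∑[ i < m ] f i +_) (∑-cong k (λ q → ∑-cong m (λ i → cong f (sym (+-assoc m (q * m) i))))) ⟩
  ∑[ q < suc k ] ∑[ i < m ] f (q * m + i)                  ∎
  where open ≡-Reasoning

∑-+ : ∀ (f g : ℕ → ℕ) k → ∑[ i < k ] (f i + g i) ≡ ∑[ i < k ] f i + ∑[ i < k ] g i
∑-+ f g zero    = refl
∑-+ f g (suc k) = trans (cong (f 0 + g 0 +_) (∑-+ (λ i → f (suc i)) (λ i → g (suc i)) k))
                        (+-+-assoc-swap (f 0) (g 0) _ _)
  where
  +-+-assoc-swap : ∀ a b c d → a + b + (c + d) ≡ a + c + (b + d)
  +-+-assoc-swap = solve-∀

∑-const : ∀ {f : ℕ → ℕ} c k → (∀ i → i < k → f i ≡ c) → ∑[ i < k ] f i ≡ k * c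
∑-const c zero    f≡c = refl
∑-const c (suc k) f≡c = cong₂ _+_ (f≡c 0 (s≤s z≤n)) (∑-const c k (λ i i<k → f≡c (suc i) (s≤s i<k)))

∑-*ʳ : ∀ (f : ℕ → ℕ) c k → ∑[ i < k ] (f i * c) ≡ ∑[ i < k ] f i * c
∑-*ʳ f c zero    = refl
∑-*ʳ f c (suc k) = trans (cong (f 0 * c +_) (∑-*ʳ (λ i → f (suc i)) c k)) (sym (*-distribʳ-+ c (f 0) _))

2*∑-identity+k≡k*k : ∀ k → 2 * ∑[ i < k ] i + k ≡ k * k
2*∑-identity+k≡k*k zero    = refl
2*∑-identity+k≡k*k (suc k) = begin
  2 * ∑[ i < suc k ] i + suc k          ≡⟨ cong (λ x → 2 * x + suc k) (∑-last (λ i → i) k) ⟩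
  2 * (∑[ i < k ] i + k) + suc k        ≡⟨ regroup (∑[ i < k ] i) k ⟩
  (2 * ∑[ i < k ] i + k) + suc (2 * k)  ≡⟨ cong (_+ suc (2 * k)) (2*∑-identity+k≡k*k k) ⟩
  k * k + suc (2 * k)                   ≡⟨ square-suc k ⟩
  suc k * suc k                         ∎
  where
  open ≡-Reasoning
  regroup : ∀ x k → 2 * (x + k) + suc k ≡ (2 * x + k) + suc (2 * k)
  regroup = solve-∀
  square-suc : ∀ k → k * k + suc (2 * k) ≡ suc k * suc k
  square-suc = solve-∀

∑-reverse-window : ∀ (f : ℕ → ℕ) k c → ∑[ j < k ] f ((k + c) ∸ j) ≡ ∑[ i < k ] f (suc c + i)
∑-reverse-window f zero    c = refl
∑-reverse-window f (suc k) c = begin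
  f (suc k + c) + ∑[ j < k ] f ((k + c) ∸ j)     ≡⟨ cong (f (suc k + c) +_) (∑-reverse-window f k c) ⟩
  f (suc k + c) + ∑[ i < k ] f (suc c + i)       ≡⟨ +-comm (f (suc k + c)) _ ⟩
  ∑[ i < k ] f (suc c + i) + f (suc k + c)       ≡⟨ cong (λ x → ∑[ i < k ] f (suc c + i) + f (suc x)) (+-comm k c) ⟩
  ∑[ i < k ] f (suc c + i) + f (suc c + k)       ≡⟨ ∑-last (λ i → f (suc c + i)) k ⟨
  ∑[ i < suc k ] f (suc c + i)                   ∎
  where open ≡-Reasoning

-- Sliding the window one step to the right replaces f c by f (c + k) = 1 + f c.
∑-sliding-window : ∀ (f : ℕ → ℕ) k → (∀ x → f (x + k) ≡ suc (f x)) →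
                   ∀ c → ∑[ i < k ] f (c + i) ≡ ∑[ i < k ] f i + c
∑-sliding-window f k step zero    = sym (+-identityʳ _)
∑-sliding-window f k step (suc c) = +-cancelʳ-≡ (f c) _ _ (begin
  ∑[ i < k ] f (suc c + i) + f c
    ≡⟨ cong₂ _+_ (∑-cong k (λ i → cong f (sym (+-suc c i)))) (cong f (sym (+-identityʳ c))) ⟩
  ∑[ i < k ] f (c + suc i) + f (c + 0)    ≡⟨ +-comm _ (f (c + 0)) ⟩
  ∑[ i < suc k ] f (c + i)                ≡⟨ ∑-last (λ i → f (c + i)) k ⟩
  ∑[ i < k ] f (c + i) + f (c + k)        ≡⟨ cong₂ _+_ (∑-sliding-window f k step c) (step c) ⟩
  ∑[ i < k ] f i + c + suc (f c)          ≡⟨ move-suc (∑[ i < k ] f i) c (f c) ⟩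
  ∑[ i < k ] f i + suc c + f c            ∎)
  where
  open ≡-Reasoning
  move-suc : ∀ x c y → x + c + suc y ≡ x + suc c + y
  move-suc = solve-∀

[q*d+r]/d≡q : ∀ q {d r} .{{_ : NonZero d}} → r < d → (q * d + r) / d ≡ q
[q*d+r]/d≡q q {d} {r} r<d = begin
  (q * d + r) / d          ≡⟨ +-distrib-/-∣ˡ r (n∣m*n q) ⟩
  q * d / d + r / d        ≡⟨ cong₂ _+_ (m*n/n≡m q d) (m<n⇒m/n≡0 r<d) ⟩
  q + 0                    ≡⟨ +-identityʳ q ⟩
  q                        ∎
  where open ≡-Reasoning

module _ {s : ℕ} .{{_ : NonZero s}} where

  private instance
    2s≢0 : NonZero (2 * s)
    2s≢0 = m*n≢0 2 s

  division⇒a≡ : ∀ n q {r} → 2 * n + s * s ≡ q * (2 * s) + r → r < 2 * s → a s n ≡ q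
  division⇒a≡ n q eq r<2s = trans (/-congˡ {o = 2 * s} eq) ([q*d+r]/d≡q q r<2s)

  a-+s : ∀ n → a s (n + s) ≡ suc (a s n)
  a-+s n = begin
    (2 * (n + s) + s * s) / (2 * s)            ≡⟨ /-congˡ {o = 2 * s} (pull-out n s) ⟩
    (2 * n + s * s + 2 * s) / (2 * s)          ≡⟨ +-distrib-/-∣ʳ (2 * n + s * s) {d = 2 * s} ∣-refl ⟩
    a s n + 2 * s / (2 * s)                    ≡⟨ cong (a s n +_) (n/n≡1 (2 * s)) ⟩
    a s n + 1                                  ≡⟨ +-comm (a s n) 1 ⟩
    suc (a s n)                                ∎
    where
    open ≡-Reasoning
    pull-out : ∀ n s → 2 * (n + s) + s * s ≡ 2 * n + s * s + 2 * s
    pull-out = solve-∀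

a-even : ∀ {m} .{{_ : NonZero (m * 2)}} i → i < m * 2 → a (m * 2) i ≡ m
a-even {m} i i<s = division⇒a≡ i m (quotient-form m i) (*-monoʳ-< 2 i<s)
  where
  quotient-form : ∀ m i → 2 * i + m * 2 * (m * 2) ≡ m * (2 * (m * 2)) + 2 * i
  quotient-form = solve-∀

a-odd-low : ∀ {m} i → i ≤ m → a (suc (m * 2)) i ≡ m
a-odd-low {m} i i≤m = division⇒a≡ i m (quotient-form m i) (begin
  suc (2 * i + suc (m * 2))   ≤⟨ s≤s (+-monoˡ-≤ _ (*-monoʳ-≤ 2 i≤m)) ⟩
  suc (2 * m + suc (m * 2))   ≡⟨ double-odd m ⟩
  2 * suc (m * 2)             ∎)
  where
  open ≤-Reasoning
  quotient-form : ∀ m i → 2 * i + suc (m * 2) * suc (m * 2) ≡ m * (2 * suc (m * 2)) + (2 * i + suc (m * 2))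
  quotient-form = solve-∀
  double-odd : ∀ m → suc (2 * m + suc (m * 2)) ≡ 2 * suc (m * 2)
  double-odd = solve-∀

a-odd-high : ∀ {m} j → j < m → a (suc (m * 2)) (suc m + j) ≡ suc m
a-odd-high {m} j j<m = division⇒a≡ (suc m + j) (suc m) (quotient-form m j) (begin
  suc (suc (2 * j))           ≡⟨ cong suc (+-suc j (j + 0)) ⟨
  2 * suc j                   ≤⟨ *-monoʳ-≤ 2 j<m ⟩
  2 * m                       ≤⟨ *-monoʳ-≤ 2 (m≤m*n m 2) ⟩
  2 * (m * 2)                 <⟨ *-monoʳ-< 2 (n<1+n (m * 2)) ⟩
  2 * suc (m * 2)             ∎)
  where
  open ≤-Reasoning
  quotient-form : ∀ m j → 2 * (suc m + j) + suc (m * 2) * suc (m * 2) ≡ suc m * (2 * suc (m * 2)) + suc (2 * j)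
  quotient-form = solve-∀

-- For s = 2m every a s i with i < s equals m; for s = 2m+1 the first m+1 values are m and the last m are m+1.
2*∑a+ρ≡s*s : ∀ {s} .{{_ : NonZero s}} ρ m → ρ < 2 → s ≡ ρ + m * 2 → 2 * ∑[ i < s ] a s i + ρ ≡ s * s
2*∑a+ρ≡s*s zero m _ refl = begin
  2 * ∑[ i < m * 2 ] a (m * 2) i + 0     ≡⟨ cong (λ x → 2 * x + 0) (∑-const m (m * 2) a-even) ⟩
  2 * (m * 2 * m) + 0                    ≡⟨ even-square m ⟩
  m * 2 * (m * 2)                        ∎
  where
  open ≡-Reasoning
  even-square : ∀ m → 2 * (m * 2 * m) + 0 ≡ m * 2 * (m * 2)
  even-square = solve-∀
2*∑a+ρ≡s*s (suc zero) m _ refl = begin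
  2 * ∑[ i < s ] a s i + 1                                  ≡⟨ cong (λ k → 2 * ∑< k (a s) + 1) (odd-split m) ⟩
  2 * ∑[ i < suc m + m ] a s i + 1                          ≡⟨ cong (λ x → 2 * x + 1) (∑-split (a s) (suc m) m) ⟩
  2 * (∑[ i < suc m ] a s i + ∑[ j < m ] a s (suc m + j)) + 1
    ≡⟨ cong (λ x → 2 * x + 1) (cong₂ _+_ (∑-const m (suc m) (λ i i≤m → a-odd-low i (≤-pred i≤m)))
                                          (∑-const (suc m) m a-odd-high)) ⟩
  2 * (suc m * m + m * suc m) + 1                           ≡⟨ odd-square m ⟩
  s * s                                                     ∎
  where
  open ≡-Reasoning
  s = suc (m * 2)
  odd-split : ∀ m → suc (m * 2) ≡ suc m + m
  odd-split = solve-∀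
  odd-square : ∀ m → 2 * (suc m * m + m * suc m) + 1 ≡ suc (m * 2) * suc (m * 2)
  odd-square = solve-∀
2*∑a+ρ≡s*s (suc (suc _)) _ (s≤s (s≤s ())) _

2*∑a+s%2≡s*s : ∀ s .{{_ : NonZero s}} → 2 * ∑[ i < s ] a s i + s % 2 ≡ s * s
2*∑a+s%2≡s*s s = 2*∑a+ρ≡s*s (s % 2) (s / 2) (m%n<n s 2) (m≡m%n+[m/n]*n s 2)

module _ {s : ℕ} .{{_ : NonZero s}} where

  S-as-window : ∀ t → S s (s * s + t) ≡ ∑[ i < s * s ] a s (suc t + i)
  S-as-window t = trans (cong sum (map-upTo (λ j → a s ((s * s + t) ∸ j)) (s * s)))
                        (∑-reverse-window (a s) (s * s) t)

  S≡ : ∀ t → S s (s * s + t) ≡ s * (∑[ i < s ] a s i + suc t) + ∑[ q < s ] q * s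
  S≡ t = begin
    S s (s * s + t)                                         ≡⟨ S-as-window t ⟩
    ∑[ i < s * s ] a s (suc t + i)                          ≡⟨ ∑-blocks (λ i → a s (suc t + i)) s s ⟩
    ∑[ q < s ] ∑[ i < s ] a s (suc t + (q * s + i))         ≡⟨ ∑-cong s block-sum ⟩
    ∑[ q < s ] (T₀ + suc t + q * s)                         ≡⟨ ∑-+ (λ _ → T₀ + suc t) (λ q → q * s) s ⟩
    ∑[ q < s ] (T₀ + suc t) + ∑[ q < s ] (q * s)            ≡⟨ cong₂ _+_ (∑-const (T₀ + suc t) s (λ _ _ → refl)) (∑-*ʳ (λ q → q) s s) ⟩
    s * (T₀ + suc t) + ∑[ q < s ] q * s                     ∎
    where
    open ≡-Reasoning
    T₀ = ∑[ i < s ] a s i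
    block-sum : ∀ q → ∑[ i < s ] a s (suc t + (q * s + i)) ≡ T₀ + suc t + q * s
    block-sum q = begin
      ∑[ i < s ] a s (suc t + (q * s + i))   ≡⟨ ∑-cong s (λ i → cong (a s) (sym (+-assoc (suc t) (q * s) i))) ⟩
      ∑[ i < s ] a s (suc t + q * s + i)     ≡⟨ ∑-sliding-window (a s) s a-+s (suc t + q * s) ⟩
      T₀ + (suc t + q * s)                   ≡⟨ +-assoc T₀ (suc t) (q * s) ⟨
      T₀ + suc t + q * s                     ∎

  2*S+s*s+s*[s%2]≡[1+n]*2s : ∀ n → s * s ≤ n → 2 * S s n + s * s + s * (s % 2) ≡ suc n * (2 * s)
  2*S+s*s+s*[s%2]≡[1+n]*2s n s*s≤n = begin
    2 * S s n + s * s + s * ρ                              ≡⟨ cong (λ m → 2 * S s m + s * s + s * ρ) n≡s*s+t ⟩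
    2 * S s (s * s + t) + s * s + s * ρ                    ≡⟨ cong (λ x → 2 * x + s * s + s * ρ) (S≡ t) ⟩
    2 * (s * (T₀ + suc t) + Δ * s) + s * s + s * ρ         ≡⟨ regroup s T₀ t Δ ρ ⟩
    s * (2 * T₀ + ρ) + s * (2 * Δ + s) + 2 * s * suc t     ≡⟨ cong₂ (λ x y → s * x + s * y + 2 * s * suc t)
                                                                    (2*∑a+s%2≡s*s s) (2*∑-identity+k≡k*k s) ⟩
    s * (s * s) + s * (s * s) + 2 * s * suc t              ≡⟨ collect s t ⟩
    suc (s * s + t) * (2 * s)                              ≡⟨ cong (λ m → suc m * (2 * s)) n≡s*s+t ⟨
    suc n * (2 * s)                                        ∎
    where
    open ≡-Reasoning
    ρ = s % 2
    t = n ∸ s * s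
    T₀ = ∑[ i < s ] a s i
    Δ = ∑[ q < s ] q
    n≡s*s+t : n ≡ s * s + t
    n≡s*s+t = sym (m+[n∸m]≡n s*s≤n)
    regroup : ∀ s T₀ t Δ ρ → 2 * (s * (T₀ + suc t) + Δ * s) + s * s + s * ρ
                           ≡ s * (2 * T₀ + ρ) + s * (2 * Δ + s) + 2 * s * suc t
    regroup = solve-∀
    collect : ∀ s t → s * (s * s) + s * (s * s) + 2 * s * suc t ≡ suc (s * s + t) * (2 * s)
    collect = solve-∀

corollary3p10 : (s : ℕ) → .{{_ : NonZero s}} → 2 ≤ s →
    ((s % 2 ≡ 1) → (n : ℕ) → s * s ≤ n → a s (S s n) ≡ n)
    × ((s % 2 ≡ 0) → (n : ℕ) → s * s ≤ n → (a s (S s n) ≢ n) × (a s (S s n) ≡ suc n))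
corollary3p10 s _ = odd , even
  where
  open ≡-Reasoning

  s<2*s : s < 2 * s
  s<2*s = subst (_< 2 * s) (*-identityˡ s) (*-monoˡ-< s (n<1+n 1))

  odd : s % 2 ≡ 1 → ∀ n → s * s ≤ n → a s (S s n) ≡ n
  odd s%2≡1 n s*s≤n = division⇒a≡ (S s n) n (+-cancelʳ-≡ s _ _ (begin
    2 * S s n + s * s + s              ≡⟨ cong (2 * S s n + s * s +_) (*-identityʳ s) ⟨
    2 * S s n + s * s + s * 1          ≡⟨ cong (λ ρ → 2 * S s n + s * s + s * ρ) s%2≡1 ⟨
    2 * S s n + s * s + s * (s % 2)    ≡⟨ 2*S+s*s+s*[s%2]≡[1+n]*2s n s*s≤n ⟩
    suc n * (2 * s)                    ≡⟨ unfold-suc n s ⟩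
    n * (2 * s) + s + s                ∎)) s<2*s
    where
    unfold-suc : ∀ n s → suc n * (2 * s) ≡ n * (2 * s) + s + s
    unfold-suc = solve-∀

  even : s % 2 ≡ 0 → ∀ n → s * s ≤ n → (a s (S s n) ≢ n) × (a s (S s n) ≡ suc n)
  even s%2≡0 n s*s≤n = (λ a[S]≡n → 1+n≢n (trans (sym a[S]≡1+n) a[S]≡n)) , a[S]≡1+n
    where
    a[S]≡1+n : a s (S s n) ≡ suc n
    a[S]≡1+n = division⇒a≡ (S s n) (suc n) (begin
      2 * S s n + s * s                  ≡⟨ +-identityʳ _ ⟨
      2 * S s n + s * s + 0              ≡⟨ cong (2 * S s n + s * s +_) (*-zeroʳ s) ⟨
      2 * S s n + s * s + s * 0          ≡⟨ cong (λ ρ → 2 * S s n + s * s + s * ρ) s%2≡0 ⟨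
      2 * S s n + s * s + s * (s % 2)    ≡⟨ 2*S+s*s+s*[s%2]≡[1+n]*2s n s*s≤n ⟩
      suc n * (2 * s)                    ≡⟨ +-identityʳ _ ⟨
      suc n * (2 * s) + 0                ∎) (≤-<-trans z≤n s<2*s)
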